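{- Let $K$ be a field and $\tau=[\mu,\nu:E\to V]$ a transformation-pair over $K$. Then the multiplicity $^0t^0_0(\tau)$ of $^0T^0_0=[0,0:K\to0]$ in the Kronecker decomposition of $\tau$ equals $\dim(\ker\mu\cap\ker\nu)$.
   Context: A transformation-pair over $K$ is $[\mu,\nu:E\to V]$ with $E,V$ finite-dimensional $K$-spaces and $\mu,\nu:E\to V$ linear; isomorphisms are pairs of linear isomorphisms $\alpha:E\to E'$, $\beta:V\to V'$ with $\mu'\alpha=\beta\mu$, $\nu'\alpha=\beta\nu$; direct sums componentwise. By Kronecker's theorem, every transformation-pair is isomorphic to a direct sum of indecomposables from the list: $^0T_n=[\mu_n,I:K^n\to K^n]$, $T^0_n=[I,\mu_n:K^n\to K^n]$ ($n\ge1$, $\mu_n:f_1\mapsto f_2\mapsto\cdots\mapsto f_n\mapsto0$ on the standard basis), $T_n=[\kappa_n,\lambda_n:K^n\to K^{n+1}]$ ($n\ge0$, $\kappa_n(f_i)=f_i$, $\lambda_n(f_i)=f_{i+1}$), $^0T^0_n=[\kappa'_n,\lambda'_n:K^{n+1}\to K^n]$ ($n\ge0$, $\kappa'_n(f_i)=f_i$ for $i\le n$, $\kappa'_n(f_{n+1})=0$, $\lambda'_n(f_1)=0$, $\lambda'_n(f_i)=f_{i-1}$ for $i\ge2$), and $S(p^n)=[\xi,I:K[X]/(p^n)\to K[X]/(p^n)]$ ($\xi$ multiplication by $X$, $p\ne X$ monic irreducible, $n\ge1$), with multiplicities independent of the decomposition. -}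

module Defs where

open import Level using (Level; _⊔_) renaming (suc to lsuc)
open import Algebra.Bundles using (CommutativeRing)
open import Data.Nat using (ℕ; zero; suc; _∸_; _≤_; _≡ᵇ_) renaming (_+_ to _+ℕ_)
import Data.Fin as F
open import Data.Fin using (Fin; toℕ; splitAt)
open import Data.Sum using (inj₁; inj₂)
open import Data.Bool using (if_then_else_)
open import Data.List using (List; []; _∷_)
open import Data.Product using (Σ; _×_; ∃)
open import Relation.Nullary using (¬_)

record Field (c ℓ : Level) : Set (lsuc (c ⊔ ℓ)) where
  field
    commutativeRing : CommutativeRing c ℓ
  open CommutativeRing commutativeRing public
  field
    1≉0     : ¬ (1# ≈ 0#)
    inverse : ∀ x → ¬ (x ≈ 0#) → Σ Carrier λ y → (x * y) ≈ 1#

module _ {c ℓ : Level} (K : Field c ℓ) where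
  open Field K using (Carrier; _≈_; _+_; _*_; -_; 0#; 1#)

  sumF : (n : ℕ) → (Fin n → Carrier) → Carrier
  sumF zero    f = 0#
  sumF (suc n) f = f F.zero + sumF n (λ i → f (F.suc i))

  sumN : ℕ → (ℕ → Carrier) → Carrier
  sumN zero    f = 0#
  sumN (suc n) f = f zero + sumN n (λ i → f (suc i))

  Vect : ℕ → Set c
  Vect n = Fin n → Carrier

  -- m rows, n columns: a linear map K^n → K^m
  Mat : ℕ → ℕ → Set c
  Mat m n = Fin m → Fin n → Carrier

  apply : ∀ {m n} → Mat m n → Vect n → Vect m
  apply {n = n} M x i = sumF n (λ j → M i j * x j)

  _⊙_ : ∀ {m n p} → Mat m n → Mat n p → Mat m p
  _⊙_ {n = n} A B i k = sumF n (λ j → A i j * B j k)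

  _≈M_ : ∀ {m n} → Mat m n → Mat m n → Set ℓ
  A ≈M B = ∀ i j → A i j ≈ B i j

  δ : ℕ → ℕ → Carrier
  δ a b = if a ≡ᵇ b then 1# else 0#

  idM : ∀ n → Mat n n
  idM n i j = δ (toℕ i) (toℕ j)

  blockDiag : ∀ {m n m' n'} → Mat m n → Mat m' n' → Mat (m +ℕ m') (n +ℕ n')
  blockDiag {m} {n} A B i j with splitAt m i | splitAt n j
  ... | inj₁ a | inj₁ b = A a b
  ... | inj₂ a | inj₂ b = B a b
  ... | _      | _      = 0#

  -- Transformation-pairs [μ, ν : E → V] with E = K^dimE, V = K^dimV


  record TP : Set c where
    field
      dimE : ℕ
      dimV : ℕ
      mu   : Mat dimV dimE
      nu   : Mat dimV dimE
  open TP public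

  record _≅_ (τ τ' : TP) : Set (c ⊔ ℓ) where
    field
      α     : Mat (dimE τ') (dimE τ)
      α⁻¹   : Mat (dimE τ) (dimE τ')
      β     : Mat (dimV τ') (dimV τ)
      β⁻¹   : Mat (dimV τ) (dimV τ')
      α-inv₁ : (α⁻¹ ⊙ α) ≈M idM (dimE τ)
      α-inv₂ : (α ⊙ α⁻¹) ≈M idM (dimE τ')
      β-inv₁ : (β⁻¹ ⊙ β) ≈M idM (dimV τ)
      β-inv₂ : (β ⊙ β⁻¹) ≈M idM (dimV τ')
      mu-comm : (mu τ' ⊙ α) ≈M (β ⊙ mu τ)
      nu-comm : (nu τ' ⊙ α) ≈M (β ⊙ nu τ)

  _⊕_ : TP → TP → TP
  τ ⊕ σ = record
    { dimE = dimE τ +ℕ dimE σ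
    ; dimV = dimV τ +ℕ dimV σ
    ; mu   = blockDiag (mu τ) (mu σ)
    ; nu   = blockDiag (nu τ) (nu σ) }

  zeroTP : TP
  zeroTP = record { dimE = 0 ; dimV = 0 ; mu = λ () ; nu = λ () }

  -- Monic polynomials X^d + c_{d-1} X^{d-1} + ... + c_0

  record Monic : Set c where
    field
      deg  : ℕ
      coef : Fin deg → Carrier
  open Monic public

  coeffSeq : (d : ℕ) → (Fin d → Carrier) → ℕ → Carrier
  coeffSeq zero    f zero    = 1#
  coeffSeq zero    f (suc k) = 0#
  coeffSeq (suc d) f zero    = f F.zero
  coeffSeq (suc d) f (suc k) = coeffSeq d (λ i → f (F.suc i)) k

  coeffN : Monic → ℕ → Carrier
  coeffN p = coeffSeq (deg p) (coef p)

  mulM : Monic → Monic → Monic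
  mulM p q = record
    { deg  = deg p +ℕ deg q
    ; coef = λ i → sumN (suc (toℕ i))
                     (λ j → coeffN p j * coeffN q (toℕ i ∸ j)) }

  oneM : Monic
  oneM = record { deg = 0 ; coef = λ () }

  powM : Monic → ℕ → Monic
  powM p zero    = oneM
  powM p (suc n) = mulM p (powM p n)

  XM : Monic
  XM = record { deg = 1 ; coef = λ _ → 0# }

  _≈P_ : Monic → Monic → Set ℓ
  p ≈P q = ∀ k → coeffN p k ≈ coeffN q k

  Irreducible : Monic → Set (c ⊔ ℓ)
  Irreducible p = (1 ≤ deg p) ×
    (∀ a b → 1 ≤ deg a → 1 ≤ deg b → ¬ (mulM a b ≈P p))

  -- matrix of multiplication by X on K[X]/(q) in the basis 1, X, ..., X^{d-1}
  companion : (q : Monic) → Mat (deg q) (deg q)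
  companion q i j =
    if suc (toℕ j) ≡ᵇ deg q then - coef q i else δ (toℕ i) (suc (toℕ j))

  -- μ_n : f_1 ↦ f_2 ↦ ... ↦ f_n ↦ 0
  shiftM : ∀ n → Mat n n
  shiftM n i j = δ (toℕ i) (suc (toℕ j))

  kappaM : ∀ n → Mat (suc n) n
  kappaM n i j = δ (toℕ i) (toℕ j)
  lambdaM : ∀ n → Mat (suc n) n
  lambdaM n i j = δ (toℕ i) (suc (toℕ j))

  kappa'M : ∀ n → Mat n (suc n)
  kappa'M n i j = δ (toℕ i) (toℕ j)
  lambda'M : ∀ n → Mat n (suc n)
  lambda'M n i j = δ (suc (toℕ i)) (toℕ j)

  data Indec : Set (c ⊔ ℓ) where
    ⁰T_  : (n : ℕ) → 1 ≤ n → Indec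
    T⁰_  : (n : ℕ) → 1 ≤ n → Indec
    T_   : (n : ℕ) → Indec
    ⁰T⁰_ : (n : ℕ) → Indec
    S    : (p : Monic) → Irreducible p → ¬ (p ≈P XM) → (n : ℕ) → 1 ≤ n → Indec

  toTP : Indec → TP
  toTP ((⁰T n) _) = record { dimE = n ; dimV = n ; mu = shiftM n ; nu = idM n }
  toTP ((T⁰ n) _) = record { dimE = n ; dimV = n ; mu = idM n ; nu = shiftM n }
  toTP (T n)      = record { dimE = n ; dimV = suc n ; mu = kappaM n ; nu = lambdaM n }
  toTP (⁰T⁰ n)    = record { dimE = suc n ; dimV = n ; mu = kappa'M n ; nu = lambda'M n }
  toTP (S p _ _ n _) = record
    { dimE = deg (powM p n) ; dimV = deg (powM p n)
    ; mu = companion (powM p n) ; nu = idM (deg (powM p n)) }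

  ⨁ : List Indec → TP
  ⨁ []       = zeroTP
  ⨁ (d ∷ ds) = toTP d ⊕ ⨁ ds

  count⁰T⁰₀ : List Indec → ℕ
  count⁰T⁰₀ []             = 0
  count⁰T⁰₀ (⁰T⁰ zero ∷ ds) = suc (count⁰T⁰₀ ds)
  count⁰T⁰₀ (_ ∷ ds)        = count⁰T⁰₀ ds

  InKerCap : (τ : TP) → Vect (dimE τ) → Set ℓ
  InKerCap τ x = (∀ i → apply (mu τ) x i ≈ 0#) × (∀ i → apply (nu τ) x i ≈ 0#)

  lincomb : ∀ {n d} → Vect d → (Fin d → Vect n) → Vect n
  lincomb {d = d} a b i = sumF d (λ k → a k * b k i)

  record IsKerCapBasis (τ : TP) (d : ℕ) (b : Fin d → Vect (dimE τ)) : Set (c ⊔ ℓ) where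
    field
      inSub : ∀ k → InKerCap τ (b k)
      indep : ∀ a → (∀ i → lincomb a b i ≈ 0#) → ∀ k → a k ≈ 0#
      spans : ∀ x → InKerCap τ x → Σ (Vect d) λ a → ∀ i → x i ≈ lincomb a b i

  DimKerCap : TP → ℕ → Set (c ⊔ ℓ)
  DimKerCap τ d = Σ (Fin d → Vect (dimE τ)) (IsKerCapBasis τ d)

-- ker μ ∩ ker ν is transported by the isomorphism α : E → E′, so its dimension is an isomorphism
-- invariant, and it is additive under direct sums because the matrices of a direct sum are block
-- diagonal.  Among the indecomposables it vanishes everywhere except on ⁰T⁰₀ = [0,0 : K → 0],
-- where it is all of K: in ⁰T_n, T⁰_n and S(pⁿ) one of the two maps is the identity, in T_n the
-- map κ_n is injective, and in ⁰T⁰_{n+1} the kernels of κ′ and λ′ are spanned by different basis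
-- vectors.
module Submission where

open import Defs
open import Level using (Level)
open import Data.Fin using (Fin; zero; suc; toℕ; splitAt; join; _↑ˡ_; _↑ʳ_; inject₁)
open import Data.Fin.Properties using (join-splitAt; splitAt-↑ˡ; splitAt-↑ʳ; toℕ-inject₁)
open import Data.List using (List; []; _∷_)
open import Data.Nat using (ℕ; zero; suc) renaming (_+_ to _+ℕ_)
open import Data.Product using (Σ; _,_; proj₁; proj₂; _×_)
open import Data.Sum using (inj₁; inj₂; _⊎_)
open import Data.Vec.Functional using (_++_)
open import Data.Vec.Functional.Properties using (lookup-++ˡ; lookup-++ʳ)
import Relation.Binary.PropositionalEquality as ≡
open ≡ using (_≡_)

↑ˡ↑ʳ-elim : ∀ {p m n} (P : Fin (m +ℕ n) → Set p) →
  (∀ i → P (i ↑ˡ n)) → (∀ j → P (m ↑ʳ j)) → ∀ k → P k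
↑ˡ↑ʳ-elim {m = m} {n} P left right k = ≡.subst P (join-splitAt m n k) (by-cases (splitAt m k))
  where
  by-cases : (s : Fin m ⊎ Fin n) → P (join m n s)
  by-cases (inj₁ i) = left i
  by-cases (inj₂ j) = right j

module KernelIntersection {c ℓ : Level} (K : Field c ℓ) where
  open Field K hiding (zero)
  open import Algebra.Properties.Semiring.Sum semiring
    using (sum; sum-cong-≋; sum-cong-≗; sum-replicate-zero; ∑-comm; *-distribˡ-sum)
  open import Relation.Binary.Reasoning.Setoid setoid

  sumF≡sum : ∀ n (f : Vect K n) → sumF K n f ≡ sum f
  sumF≡sum zero    f = ≡.refl
  sumF≡sum (suc n) f = ≡.cong (f zero +_) (sumF≡sum n (λ i → f (suc i)))

  sumF-cong : ∀ n {f g : Vect K n} → (∀ i → f i ≈ g i) → sumF K n f ≈ sumF K n g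
  sumF-cong n {f} {g} f≈g =
    trans (reflexive (sumF≡sum n f)) (trans (sum-cong-≋ f≈g) (reflexive (≡.sym (sumF≡sum n g))))

  sumF-zero : ∀ n {f : Vect K n} → (∀ i → f i ≈ 0#) → sumF K n f ≈ 0#
  sumF-zero n {f} f≈0 = trans (reflexive (sumF≡sum n f)) (trans (sum-cong-≋ f≈0) (sum-replicate-zero n))

  *-distribˡ-sumF : ∀ n a (f : Vect K n) → a * sumF K n f ≈ sumF K n (λ i → a * f i)
  *-distribˡ-sumF n a f = trans (*-congˡ (reflexive (sumF≡sum n f)))
    (trans (*-distribˡ-sum a f) (reflexive (≡.sym (sumF≡sum n (λ i → a * f i)))))

  sumF-comm : ∀ m n (f : Fin m → Fin n → Carrier) →
    sumF K m (λ i → sumF K n (f i)) ≈ sumF K n (λ j → sumF K m (λ i → f i j))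
  sumF-comm m n f = trans (reflexive (double m n f))
    (trans (∑-comm f) (reflexive (≡.sym (double n m (λ j i → f i j)))))
    where
    double : ∀ m n (f : Fin m → Fin n → Carrier) →
      sumF K m (λ i → sumF K n (f i)) ≡ sum (λ i → sum (f i))
    double m n f = ≡.trans (sumF≡sum m _) (sum-cong-≗ (λ i → sumF≡sum n (f i)))

  sumF-↑ˡ↑ʳ : ∀ m n (f : Vect K (m +ℕ n)) →
    sumF K (m +ℕ n) f ≈ sumF K m (λ i → f (i ↑ˡ n)) + sumF K n (λ j → f (m ↑ʳ j))
  sumF-↑ˡ↑ʳ zero    n f = sym (+-identityˡ _)
  sumF-↑ˡ↑ʳ (suc m) n f = trans (+-congˡ (sumF-↑ˡ↑ʳ m n (λ i → f (suc i)))) (sym (+-assoc _ _ _))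

  sumF-δˡ : ∀ n (x : Vect K n) i → sumF K n (λ j → δ K (toℕ i) (toℕ j) * x j) ≈ x i
  sumF-δˡ (suc n) x zero    = trans (+-cong (*-identityˡ _) (sumF-zero n (λ _ → zeroˡ _))) (+-identityʳ _)
  sumF-δˡ (suc n) x (suc i) = trans (+-cong (zeroˡ _) (sumF-δˡ n (λ j → x (suc j)) i)) (+-identityˡ _)

  sumF-δʳ : ∀ n (x : Vect K n) i → sumF K n (λ j → x j * δ K (toℕ j) (toℕ i)) ≈ x i
  sumF-δʳ (suc n) x zero    = trans (+-cong (*-identityʳ _) (sumF-zero n (λ _ → zeroʳ _))) (+-identityʳ _)
  sumF-δʳ (suc n) x (suc i) = trans (+-cong (zeroʳ _) (sumF-δʳ n (λ j → x (suc j)) i)) (+-identityˡ _)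

  InKer : ∀ {m n} → Mat K m n → Vect K n → Set ℓ
  InKer M x = ∀ i → apply K M x i ≈ 0#

  apply-congˡ : ∀ {m n} {A B : Mat K m n} → _≈M_ K A B → ∀ x i → apply K A x i ≈ apply K B x i
  apply-congˡ {n = n} A≈B x i = sumF-cong n (λ j → *-congʳ (A≈B i j))

  apply-congʳ : ∀ {m n} (A : Mat K m n) {x y : Vect K n} → (∀ j → x j ≈ y j) →
    ∀ i → apply K A x i ≈ apply K A y i
  apply-congʳ {n = n} A x≈y i = sumF-cong n (λ j → *-congˡ (x≈y j))

  apply-zeroʳ : ∀ {m n} (A : Mat K m n) {x : Vect K n} → (∀ j → x j ≈ 0#) → InKer A x
  apply-zeroʳ {n = n} A x≈0 i = sumF-zero n (λ j → trans (*-congˡ (x≈0 j)) (zeroʳ _))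

  apply-idM : ∀ n (x : Vect K n) i → apply K (idM K n) x i ≈ x i
  apply-idM = sumF-δˡ

  apply-⊙ : ∀ {m n p} (A : Mat K m n) (B : Mat K n p) (x : Vect K p) i →
    apply K (_⊙_ K A B) x i ≈ apply K A (apply K B x) i
  apply-⊙ {n = n} {p} A B x i = begin
    sumF K p (λ k → sumF K n (λ j → A i j * B j k) * x k)
      ≈⟨ sumF-cong p (λ k → trans (*-comm _ _) (*-distribˡ-sumF n (x k) _)) ⟩
    sumF K p (λ k → sumF K n (λ j → x k * (A i j * B j k)))
      ≈⟨ sumF-comm p n _ ⟩
    sumF K n (λ j → sumF K p (λ k → x k * (A i j * B j k)))
      ≈⟨ sumF-cong n (λ j → sumF-cong p (λ k → trans (*-comm _ _) (*-assoc _ _ _))) ⟩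
    sumF K n (λ j → sumF K p (λ k → A i j * (B j k * x k)))
      ≈⟨ sumF-cong n (λ j → sym (*-distribˡ-sumF p (A i j) _)) ⟩
    sumF K n (λ j → A i j * apply K B x j) ∎

  apply-lincomb : ∀ {m n d} (A : Mat K m n) (a : Vect K d) (b : Fin d → Vect K n) i →
    apply K A (lincomb K a b) i ≈ lincomb K a (λ k → apply K A (b k)) i
  apply-lincomb {n = n} {d} A a b i = begin
    sumF K n (λ j → A i j * sumF K d (λ k → a k * b k j))
      ≈⟨ sumF-cong n (λ j → *-distribˡ-sumF d (A i j) _) ⟩
    sumF K n (λ j → sumF K d (λ k → A i j * (a k * b k j)))
      ≈⟨ sumF-comm n d _ ⟩
    sumF K d (λ k → sumF K n (λ j → A i j * (a k * b k j)))
      ≈⟨ sumF-cong d (λ k → sumF-cong n (λ j → x∙yz≈y∙xz (A i j) (a k) (b k j))) ⟩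
    sumF K d (λ k → sumF K n (λ j → a k * (A i j * b k j)))
      ≈⟨ sumF-cong d (λ k → sym (*-distribˡ-sumF n (a k) _)) ⟩
    sumF K d (λ k → a k * apply K A (b k) i) ∎
    where
    open import Algebra.Properties.CommutativeSemigroup *-commutativeSemigroup using (x∙yz≈y∙xz)

  apply-inverse : ∀ {m n} (A : Mat K n m) (B : Mat K m n) → _≈M_ K (_⊙_ K A B) (idM K n) →
    ∀ x i → apply K A (apply K B x) i ≈ x i
  apply-inverse A B AB≈I x i =
    trans (sym (apply-⊙ A B x i)) (trans (apply-congˡ AB≈I x i) (apply-idM _ x i))

  InKer-resp : ∀ {m n} (M : Mat K m n) {x y : Vect K n} → (∀ j → x j ≈ y j) → InKer M x → InKer M y
  InKer-resp M x≈y Mx≈0 i = trans (sym (apply-congʳ M x≈y i)) (Mx≈0 i)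

  InKerCap-resp : ∀ τ {x y : Vect K (dimE τ)} → (∀ j → x j ≈ y j) → InKerCap K τ x → InKerCap K τ y
  InKerCap-resp τ x≈y (μx≈0 , νx≈0) = InKer-resp (mu τ) x≈y μx≈0 , InKer-resp (nu τ) x≈y νx≈0

  InKer-idM : ∀ {n} {x : Vect K n} → InKer (idM K n) x → ∀ j → x j ≈ 0#
  InKer-idM {n} {x} x∈ j = trans (sym (apply-idM n x j)) (x∈ j)

  lincomb-congˡ : ∀ {n d} {a a′ : Vect K d} (b : Fin d → Vect K n) → (∀ k → a k ≈ a′ k) →
    ∀ i → lincomb K a b i ≈ lincomb K a′ b i
  lincomb-congˡ {d = d} b a≈a′ i = sumF-cong d (λ k → *-congʳ (a≈a′ k))

  lincomb-congʳ : ∀ {n n′ d} (a : Vect K d) (b : Fin d → Vect K n) (b′ : Fin d → Vect K n′) i i′ →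
    (∀ k → b k i ≈ b′ k i′) → lincomb K a b i ≈ lincomb K a b′ i′
  lincomb-congʳ {d = d} a b b′ i i′ b≈b′ = sumF-cong d (λ k → *-congˡ (b≈b′ k))

  lincomb-vanishing : ∀ {n d} (a : Vect K d) (b : Fin d → Vect K n) i →
    (∀ k → b k i ≈ 0#) → lincomb K a b i ≈ 0#
  lincomb-vanishing {d = d} a b i b≈0 = sumF-zero d (λ k → trans (*-congˡ (b≈0 k)) (zeroʳ _))

  lincomb-++ : ∀ {n d d′} (a : Vect K (d +ℕ d′)) (b : Fin d → Vect K n) (b′ : Fin d′ → Vect K n) i →
    lincomb K a (b ++ b′) i ≈ lincomb K (λ k → a (k ↑ˡ d′)) b i + lincomb K (λ k → a (d ↑ʳ k)) b′ i
  lincomb-++ {d = d} {d′} a b b′ i = trans (sumF-↑ˡ↑ʳ d d′ _)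
    (+-cong (sumF-cong d (λ k → *-congˡ (reflexive (≡.cong (λ v → v i) (lookup-++ˡ b b′ k)))))
            (sumF-cong d′ (λ k → *-congˡ (reflexive (≡.cong (λ v → v i) (lookup-++ʳ b b′ k))))))

  lincomb-idM : ∀ {n} (a : Vect K n) i → lincomb K a (idM K n) i ≈ a i
  lincomb-idM {n} = sumF-δʳ n

  -- Invariance under isomorphism

  InKer-intertwine : ∀ {m n m′ n′} {M : Mat K m n} {M′ : Mat K m′ n′} {α : Mat K n′ n} {β : Mat K m′ m} →
    _≈M_ K (_⊙_ K M′ α) (_⊙_ K β M) → ∀ {x} → InKer M x → InKer M′ (apply K α x)
  InKer-intertwine {M = M} {M′} {α} {β} M′α≈βM {x} Mx≈0 i =
    trans (sym (apply-⊙ M′ α x i)) (trans (apply-congˡ M′α≈βM x i)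
      (trans (apply-⊙ β M x i) (apply-zeroʳ β Mx≈0 i)))

  InKer-intertwine⁻ : ∀ {m n m′ n′} {M : Mat K m n} {M′ : Mat K m′ n′} {α : Mat K n′ n}
    {β : Mat K m′ m} (β⁻¹ : Mat K m m′) → _≈M_ K (_⊙_ K β⁻¹ β) (idM K m) →
    _≈M_ K (_⊙_ K M′ α) (_⊙_ K β M) → ∀ {x} → InKer M′ (apply K α x) → InKer M x
  InKer-intertwine⁻ {M = M} {M′} {α} {β} β⁻¹ β⁻¹β≈I M′α≈βM {x} M′αx≈0 i =
    trans (sym (apply-inverse β⁻¹ β β⁻¹β≈I (apply K M x) i))
      (trans (apply-congʳ β⁻¹ βMx≈M′αx i) (apply-zeroʳ β⁻¹ M′αx≈0 i))
    where
    βMx≈M′αx : ∀ j → apply K β (apply K M x) j ≈ apply K M′ (apply K α x) j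
    βMx≈M′αx j = trans (sym (apply-⊙ β M x j))
      (trans (sym (apply-congˡ M′α≈βM x j)) (apply-⊙ M′ α x j))

  InKerCap-≅⁺ : ∀ {τ σ} (τ≅σ : _≅_ K τ σ) {x} → InKerCap K τ x → InKerCap K σ (apply K (_≅_.α τ≅σ) x)
  InKerCap-≅⁺ {τ} {σ} τ≅σ (μx≈0 , νx≈0) =
    InKer-intertwine {M = mu τ} {mu σ} {α} {β} mu-comm μx≈0 ,
    InKer-intertwine {M = nu τ} {nu σ} {α} {β} nu-comm νx≈0
    where open _≅_ τ≅σ

  InKerCap-≅⁻ : ∀ {τ σ} (τ≅σ : _≅_ K τ σ) {x} → InKerCap K σ (apply K (_≅_.α τ≅σ) x) → InKerCap K τ x
  InKerCap-≅⁻ {τ} {σ} τ≅σ (μαx≈0 , ναx≈0) =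
    InKer-intertwine⁻ {M = mu τ} {mu σ} {α} {β} β⁻¹ β-inv₁ mu-comm μαx≈0 ,
    InKer-intertwine⁻ {M = nu τ} {nu σ} {α} {β} β⁻¹ β-inv₁ nu-comm ναx≈0
    where open _≅_ τ≅σ

  DimKerCap-≅ : ∀ {τ σ d} → _≅_ K τ σ → DimKerCap K σ d → DimKerCap K τ d
  DimKerCap-≅ {τ} {σ} {d} τ≅σ (s , s-basis) =
    b , record { inSub = inSub ; indep = indep ; spans = spans }
    where
    open _≅_ τ≅σ
    open IsKerCapBasis s-basis renaming (inSub to s-inSub; indep to s-indep; spans to s-spans)

    b : Fin d → Vect K (dimE τ)
    b k = apply K α⁻¹ (s k)

    αb≈s : ∀ k j → apply K α (b k) j ≈ s k j
    αb≈s k = apply-inverse α α⁻¹ α-inv₂ (s k)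

    inSub : ∀ k → InKerCap K τ (b k)
    inSub k = InKerCap-≅⁻ τ≅σ (InKerCap-resp σ (λ j → sym (αb≈s k j)) (s-inSub k))

    indep : ∀ a → (∀ i → lincomb K a b i ≈ 0#) → ∀ k → a k ≈ 0#
    indep a ab≈0 = s-indep a λ i → begin
      lincomb K a s i
        ≈⟨ lincomb-congʳ a s (λ k → apply K α (b k)) i i (λ k → sym (αb≈s k i)) ⟩
      lincomb K a (λ k → apply K α (b k)) i  ≈⟨ apply-lincomb α a b i ⟨
      apply K α (lincomb K a b) i            ≈⟨ apply-zeroʳ α ab≈0 i ⟩
      0#                                     ∎

    spans : ∀ x → InKerCap K τ x → Σ (Vect K d) λ a → ∀ i → x i ≈ lincomb K a b i
    spans x x∈ with s-spans (apply K α x) (InKerCap-≅⁺ τ≅σ x∈)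
    ... | a , αx≈as = a , λ i → begin
      x i                                ≈⟨ apply-inverse α⁻¹ α α-inv₁ x i ⟨
      apply K α⁻¹ (apply K α x) i        ≈⟨ apply-congʳ α⁻¹ αx≈as i ⟩
      apply K α⁻¹ (lincomb K a s) i      ≈⟨ apply-lincomb α⁻¹ a s i ⟩
      lincomb K a b i                    ∎

  -- Additivity under direct sums

  blockDiag-↑ˡ↑ˡ : ∀ {m n m′ n′} (A : Mat K m n) (B : Mat K m′ n′) i j →
    blockDiag K A B (i ↑ˡ m′) (j ↑ˡ n′) ≡ A i j
  blockDiag-↑ˡ↑ˡ {m} {n} {m′} {n′} A B i j rewrite splitAt-↑ˡ m i m′ | splitAt-↑ˡ n j n′ = ≡.refl

  blockDiag-↑ˡ↑ʳ : ∀ {m n m′ n′} (A : Mat K m n) (B : Mat K m′ n′) i j →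
    blockDiag K A B (i ↑ˡ m′) (n ↑ʳ j) ≡ 0#
  blockDiag-↑ˡ↑ʳ {m} {n} {m′} {n′} A B i j rewrite splitAt-↑ˡ m i m′ | splitAt-↑ʳ n n′ j = ≡.refl

  blockDiag-↑ʳ↑ˡ : ∀ {m n m′ n′} (A : Mat K m n) (B : Mat K m′ n′) i j →
    blockDiag K A B (m ↑ʳ i) (j ↑ˡ n′) ≡ 0#
  blockDiag-↑ʳ↑ˡ {m} {n} {m′} {n′} A B i j rewrite splitAt-↑ʳ m m′ i | splitAt-↑ˡ n j n′ = ≡.refl

  blockDiag-↑ʳ↑ʳ : ∀ {m n m′ n′} (A : Mat K m n) (B : Mat K m′ n′) i j →
    blockDiag K A B (m ↑ʳ i) (n ↑ʳ j) ≡ B i j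
  blockDiag-↑ʳ↑ʳ {m} {n} {m′} {n′} A B i j rewrite splitAt-↑ʳ m m′ i | splitAt-↑ʳ n n′ j = ≡.refl

  apply-blockDiag-↑ˡ : ∀ {m n m′ n′} (A : Mat K m n) (B : Mat K m′ n′) (x : Vect K (n +ℕ n′)) i →
    apply K (blockDiag K A B) x (i ↑ˡ m′) ≈ apply K A (λ j → x (j ↑ˡ n′)) i
  apply-blockDiag-↑ˡ {n = n} {n′ = n′} A B x i = trans (sumF-↑ˡ↑ʳ n n′ _)
    (trans (+-cong (sumF-cong n (λ j → *-congʳ (reflexive (blockDiag-↑ˡ↑ˡ A B i j))))
                   (sumF-zero n′ (λ j → trans (*-congʳ (reflexive (blockDiag-↑ˡ↑ʳ A B i j))) (zeroˡ _))))
      (+-identityʳ _))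

  apply-blockDiag-↑ʳ : ∀ {m n m′ n′} (A : Mat K m n) (B : Mat K m′ n′) (x : Vect K (n +ℕ n′)) i →
    apply K (blockDiag K A B) x (m ↑ʳ i) ≈ apply K B (λ j → x (n ↑ʳ j)) i
  apply-blockDiag-↑ʳ {n = n} {n′ = n′} A B x i = trans (sumF-↑ˡ↑ʳ n n′ _)
    (trans (+-cong (sumF-zero n (λ j → trans (*-congʳ (reflexive (blockDiag-↑ʳ↑ˡ A B i j))) (zeroˡ _)))
                   (sumF-cong n′ (λ j → *-congʳ (reflexive (blockDiag-↑ʳ↑ʳ A B i j)))))
      (+-identityˡ _))

  InKer-blockDiag⁺ : ∀ {m n m′ n′} (A : Mat K m n) (B : Mat K m′ n′) {x : Vect K (n +ℕ n′)} →
    InKer A (λ j → x (j ↑ˡ n′)) → InKer B (λ j → x (n ↑ʳ j)) → InKer (blockDiag K A B) x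
  InKer-blockDiag⁺ A B {x} Ax≈0 Bx≈0 = ↑ˡ↑ʳ-elim _
    (λ i → trans (apply-blockDiag-↑ˡ A B x i) (Ax≈0 i))
    (λ i → trans (apply-blockDiag-↑ʳ A B x i) (Bx≈0 i))

  InKer-blockDiag⁻ : ∀ {m n m′ n′} (A : Mat K m n) (B : Mat K m′ n′) {x : Vect K (n +ℕ n′)} →
    InKer (blockDiag K A B) x → InKer A (λ j → x (j ↑ˡ n′)) × InKer B (λ j → x (n ↑ʳ j))
  InKer-blockDiag⁻ {m} {m′ = m′} A B {x} x∈ =
    (λ i → trans (sym (apply-blockDiag-↑ˡ A B x i)) (x∈ (i ↑ˡ m′))) ,
    (λ i → trans (sym (apply-blockDiag-↑ʳ A B x i)) (x∈ (m ↑ʳ i)))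

  InKerCap-⊕⁺ : ∀ τ σ {x : Vect K (dimE τ +ℕ dimE σ)} →
    InKerCap K τ (λ j → x (j ↑ˡ dimE σ)) → InKerCap K σ (λ j → x (dimE τ ↑ʳ j)) →
    InKerCap K (_⊕_ K τ σ) x
  InKerCap-⊕⁺ τ σ (μx≈0 , νx≈0) (μy≈0 , νy≈0) =
    InKer-blockDiag⁺ (mu τ) (mu σ) μx≈0 μy≈0 , InKer-blockDiag⁺ (nu τ) (nu σ) νx≈0 νy≈0

  InKerCap-⊕⁻ : ∀ τ σ {x : Vect K (dimE τ +ℕ dimE σ)} → InKerCap K (_⊕_ K τ σ) x →
    InKerCap K τ (λ j → x (j ↑ˡ dimE σ)) × InKerCap K σ (λ j → x (dimE τ ↑ʳ j))
  InKerCap-⊕⁻ τ σ (μx≈0 , νx≈0) with InKer-blockDiag⁻ (mu τ) (mu σ) μx≈0 | InKer-blockDiag⁻ (nu τ) (nu σ) νx≈0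
  ... | μl , μr | νl , νr = (μl , νl) , (μr , νr)

  InKerCap-++ : ∀ τ σ {u v} → InKerCap K τ u → InKerCap K σ v → InKerCap K (_⊕_ K τ σ) (u ++ v)
  InKerCap-++ τ σ {u} {v} u∈ v∈ = InKerCap-⊕⁺ τ σ
    (InKerCap-resp τ (λ j → reflexive (≡.sym (lookup-++ˡ u v j))) u∈)
    (InKerCap-resp σ (λ j → reflexive (≡.sym (lookup-++ʳ u v j))) v∈)

  InKerCap-zero : ∀ τ → InKerCap K τ (λ _ → 0#)
  InKerCap-zero τ = apply-zeroʳ (mu τ) (λ _ → refl) , apply-zeroʳ (nu τ) (λ _ → refl)

  DimKerCap-⊕ : ∀ {τ σ m n} → DimKerCap K τ m → DimKerCap K σ n → DimKerCap K (_⊕_ K τ σ) (m +ℕ n)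
  DimKerCap-⊕ {τ} {σ} {m} {n} (bτ , bτ-basis) (bσ , bσ-basis) =
    b , record { inSub = inSub ; indep = indep ; spans = spans }
    where
    module Bτ = IsKerCapBasis bτ-basis
    module Bσ = IsKerCapBasis bσ-basis
    eτ = dimE τ
    eσ = dimE σ
    0v : ∀ e → Vect K e
    0v _ _ = 0#

    bˡ : Fin m → Vect K (eτ +ℕ eσ)
    bˡ k = bτ k ++ 0v eσ

    bʳ : Fin n → Vect K (eτ +ℕ eσ)
    bʳ k = 0v eτ ++ bσ k

    b : Fin (m +ℕ n) → Vect K (eτ +ℕ eσ)
    b = bˡ ++ bʳ

    b-↑ˡ : ∀ a j → lincomb K a b (j ↑ˡ eσ) ≈ lincomb K (λ k → a (k ↑ˡ n)) bτ j
    b-↑ˡ a j = trans (lincomb-++ a bˡ bʳ (j ↑ˡ eσ))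
      (trans (+-cong (lincomb-congʳ _ bˡ bτ (j ↑ˡ eσ) j (λ k → reflexive (lookup-++ˡ (bτ k) (0v eσ) j)))
                     (lincomb-vanishing _ bʳ (j ↑ˡ eσ) (λ k → reflexive (lookup-++ˡ (0v eτ) (bσ k) j))))
        (+-identityʳ _))

    b-↑ʳ : ∀ a j → lincomb K a b (eτ ↑ʳ j) ≈ lincomb K (λ k → a (m ↑ʳ k)) bσ j
    b-↑ʳ a j = trans (lincomb-++ a bˡ bʳ (eτ ↑ʳ j))
      (trans (+-cong (lincomb-vanishing _ bˡ (eτ ↑ʳ j) (λ k → reflexive (lookup-++ʳ (bτ k) (0v eσ) j)))
                     (lincomb-congʳ _ bʳ bσ (eτ ↑ʳ j) j (λ k → reflexive (lookup-++ʳ (0v eτ) (bσ k) j))))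
        (+-identityˡ _))

    inSub : ∀ k → InKerCap K (_⊕_ K τ σ) (b k)
    inSub = ↑ˡ↑ʳ-elim _
      (λ k → ≡.subst (InKerCap K (_⊕_ K τ σ)) (≡.sym (lookup-++ˡ bˡ bʳ k))
               (InKerCap-++ τ σ (Bτ.inSub k) (InKerCap-zero σ)))
      (λ k → ≡.subst (InKerCap K (_⊕_ K τ σ)) (≡.sym (lookup-++ʳ bˡ bʳ k))
               (InKerCap-++ τ σ (InKerCap-zero τ) (Bσ.inSub k)))

    indep : ∀ a → (∀ i → lincomb K a b i ≈ 0#) → ∀ k → a k ≈ 0#
    indep a ab≈0 = ↑ˡ↑ʳ-elim _
      (Bτ.indep _ (λ j → trans (sym (b-↑ˡ a j)) (ab≈0 (j ↑ˡ eσ))))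
      (Bσ.indep _ (λ j → trans (sym (b-↑ʳ a j)) (ab≈0 (eτ ↑ʳ j))))

    spans : ∀ x → InKerCap K (_⊕_ K τ σ) x → Σ (Vect K (m +ℕ n)) λ a → ∀ i → x i ≈ lincomb K a b i
    spans x x∈ with InKerCap-⊕⁻ τ σ x∈
    ... | xτ∈ , xσ∈ with Bτ.spans _ xτ∈ | Bσ.spans _ xσ∈
    ...   | aτ , xτ≈ | aσ , xσ≈ = aτ ++ aσ , ↑ˡ↑ʳ-elim _
      (λ j → trans (xτ≈ j) (trans (lincomb-congˡ bτ (λ k → reflexive (≡.sym (lookup-++ˡ aτ aσ k))) j)
                                  (sym (b-↑ˡ (aτ ++ aσ) j))))
      (λ j → trans (xσ≈ j) (trans (lincomb-congˡ bσ (λ k → reflexive (≡.sym (lookup-++ʳ aτ aσ k))) j)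
                                  (sym (b-↑ʳ (aτ ++ aσ) j))))

  -- The indecomposables

  DimKerCap-trivial : ∀ τ → (∀ x → InKerCap K τ x → ∀ j → x j ≈ 0#) → DimKerCap K τ 0
  DimKerCap-trivial τ x≈0 = (λ ()) , record
    { inSub = λ ()
    ; indep = λ _ _ ()
    ; spans = λ x x∈ → (λ ()) , x≈0 x x∈ }

  DimKerCap-total : ∀ τ → (∀ x → InKerCap K τ x) → DimKerCap K τ (dimE τ)
  DimKerCap-total τ all∈ = idM K (dimE τ) , record
    { inSub = λ k → all∈ _
    ; indep = λ a aI≈0 k → trans (sym (lincomb-idM a k)) (aI≈0 k)
    ; spans = λ x _ → x , λ i → sym (lincomb-idM x i) }

  InKer-kappaM : ∀ n {x : Vect K n} → InKer (kappaM K n) x → ∀ j → x j ≈ 0#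
  InKer-kappaM n {x} κx≈0 j = trans (sym (apply-idM n x j))
    (trans (reflexive (≡.cong (λ t → sumF K n (λ k → δ K t (toℕ k) * x k)) (≡.sym (toℕ-inject₁ j))))
           (κx≈0 (inject₁ j)))

  InKerCap-⁰T⁰-suc : ∀ n x → InKerCap K (toTP K (⁰T⁰ (suc n))) x → ∀ j → x j ≈ 0#
  InKerCap-⁰T⁰-suc n x (κ′x≈0 , _) zero    = trans (sym (apply-idM (suc (suc n)) x zero)) (κ′x≈0 zero)
  InKerCap-⁰T⁰-suc n x (_ , λ′x≈0) (suc j) = trans (sym (apply-idM (suc (suc n)) x (suc j))) (λ′x≈0 j)

  DimKerCap-toTP : ∀ d → DimKerCap K (toTP K d) (count⁰T⁰₀ K (d ∷ []))
  DimKerCap-toTP ((⁰T _) _)     = DimKerCap-trivial _ (λ _ x∈ → InKer-idM (proj₂ x∈))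
  DimKerCap-toTP ((T⁰ _) _)     = DimKerCap-trivial _ (λ _ x∈ → InKer-idM (proj₁ x∈))
  DimKerCap-toTP (T n)          = DimKerCap-trivial _ (λ _ x∈ → InKer-kappaM n (proj₁ x∈))
  DimKerCap-toTP (⁰T⁰ zero)     = DimKerCap-total _ (λ _ → (λ ()) , (λ ()))
  DimKerCap-toTP (⁰T⁰ (suc n))  = DimKerCap-trivial _ (InKerCap-⁰T⁰-suc n)
  DimKerCap-toTP (S _ _ _ _ _)  = DimKerCap-trivial _ (λ _ x∈ → InKer-idM (proj₂ x∈))

  count⁰T⁰₀-∷ : ∀ d ds → count⁰T⁰₀ K (d ∷ ds) ≡ count⁰T⁰₀ K (d ∷ []) +ℕ count⁰T⁰₀ K ds
  count⁰T⁰₀-∷ ((⁰T _) _)    ds = ≡.refl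
  count⁰T⁰₀-∷ ((T⁰ _) _)    ds = ≡.refl
  count⁰T⁰₀-∷ (T _)         ds = ≡.refl
  count⁰T⁰₀-∷ (⁰T⁰ zero)    ds = ≡.refl
  count⁰T⁰₀-∷ (⁰T⁰ (suc _)) ds = ≡.refl
  count⁰T⁰₀-∷ (S _ _ _ _ _) ds = ≡.refl

  DimKerCap-⨁ : ∀ ds → DimKerCap K (⨁ K ds) (count⁰T⁰₀ K ds)
  DimKerCap-⨁ []       = DimKerCap-trivial _ (λ _ _ ())
  DimKerCap-⨁ (d ∷ ds) = ≡.subst (DimKerCap K (⨁ K (d ∷ ds))) (≡.sym (count⁰T⁰₀-∷ d ds))
    (DimKerCap-⊕ (DimKerCap-toTP d) (DimKerCap-⨁ ds))

proposition5p7 : {c ℓ : Level} (K : Field c ℓ) (τ : TP K) (ds : List (Indec K))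
    → _≅_ K τ (⨁ K ds) → DimKerCap K τ (count⁰T⁰₀ K ds)
proposition5p7 K τ ds τ≅⨁ds = DimKerCap-≅ τ≅⨁ds (DimKerCap-⨁ ds)
  where open KernelIntersection K
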